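{- Let $D=(E,\mathcal{F})$ be a delta-matroid and let $e_1,e_2\in E$ with $e_1\neq e_2$. Then the primal type of $e_2$ in $D-e_1$ is the same as its primal type in $D$.
   Context: A set system is a pair $D=(E,\mathcal{F})$ with $E$ finite and $\mathcal{F}$ a collection of subsets of $E$. A delta-matroid is a set system with $\mathcal{F}\neq\emptyset$ such that for any $X,Y\in\mathcal{F}$ and any $u\in X\Delta Y$ there exists $v\in X\Delta Y$ (possibly $v=u$) with $X\Delta\{u,v\}\in\mathcal{F}$. For $A\subseteq E$, $D*A=(E,\{A\Delta X\mid X\in\mathcal{F}\})$; write $D*e$ for $D*\{e\}$. An element $e$ is a coloop if $e\in F$ for all $F\in\mathcal{F}$ and a loop if $e\notin F$ for all $F\in\mathcal{F}$. The deletion $D-e$ is $(E-e,\{F\in\mathcal{F}\mid e\notin F\})$ if $e$ is not a coloop, and $(E-e,\{F-e\mid F\in\mathcal{F}\})$ if $e$ is a coloop. Let $D_{\min}=(E,\mathcal{F}_{\min}(D))$ where $\mathcal{F}_{\min}(D)$ is the set of feasible sets of minimum cardinality. An element $e$ is a ribbon loop of $D$ if it is a loop of $D_{\min}$; a ribbon loop $e$ is non-orientable if it is still a ribbon loop in $D*e$, and orientable otherwise. The primal type of $e$ in $D$ is $p$ if $e$ is not a ribbon loop, $u$ if it is an orientable ribbon loop, and $t$ if it is a non-orientable ribbon loop. -}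

module Defs where

open import Data.Nat using (ℕ; suc; _≤_)
open import Data.Bool using (Bool; _xor_)
open import Data.Fin using (Fin)
open import Data.Fin.Subset using (Subset; _∈_; _∉_; _∪_; ⁅_⁆; ∣_∣)
open import Data.Vec using (zipWith; removeAt)
open import Data.Product using (Σ; ∃; ∃-syntax; _×_)
open import Data.Sum using (_⊎_)
open import Relation.Nullary using (¬_)
open import Relation.Binary.PropositionalEquality using (_≡_)

SetSystem : ℕ → Set₁
SetSystem n = Subset n → Set

_Δ_ : ∀ {n} → Subset n → Subset n → Subset n
X Δ Y = zipWith _xor_ X Y

IsDeltaMatroid : ∀ {n} → SetSystem n → Set
IsDeltaMatroid {n} 𝓕 =
  (∃[ X ] 𝓕 X) ×
  (∀ (X Y : Subset n) → 𝓕 X → 𝓕 Y → ∀ (u : Fin n) → u ∈ (X Δ Y) →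
     ∃[ v ] (v ∈ (X Δ Y) × 𝓕 (X Δ (⁅ u ⁆ ∪ ⁅ v ⁆))))

record DeltaMatroid (n : ℕ) : Set₁ where
  field
    feasible : SetSystem n
    isDeltaMatroid : IsDeltaMatroid feasible
open DeltaMatroid public

twist : ∀ {n} → SetSystem n → Subset n → SetSystem n
twist 𝓕 A Y = ∃[ X ] (𝓕 X × Y ≡ A Δ X)

IsColoop : ∀ {n} → SetSystem n → Fin n → Set
IsColoop {n} 𝓕 e = ∀ (X : Subset n) → 𝓕 X → e ∈ X

IsLoop : ∀ {n} → SetSystem n → Fin n → Set
IsLoop {n} 𝓕 e = ∀ (X : Subset n) → 𝓕 X → e ∉ X

-- deletion D - e; ground set Fin (suc m) minus e is identified with Fin m
-- via removeAt (element j of Fin m corresponds to punchIn e j).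
delete : ∀ {m} → SetSystem (suc m) → Fin (suc m) → SetSystem m
delete 𝓕 e Y =
  (IsColoop 𝓕 e × ∃[ X ] (𝓕 X × removeAt X e ≡ Y)) ⊎
  (¬ IsColoop 𝓕 e × ∃[ X ] (𝓕 X × e ∉ X × removeAt X e ≡ Y))

minimal : ∀ {n} → SetSystem n → SetSystem n
minimal {n} 𝓕 X = 𝓕 X × (∀ (Y : Subset n) → 𝓕 Y → ∣ X ∣ ≤ ∣ Y ∣)

IsRibbonLoop : ∀ {n} → SetSystem n → Fin n → Set
IsRibbonLoop 𝓕 e = IsLoop (minimal 𝓕) e

data PrimalType : Set where
  p u t : PrimalType

HasPrimalType : ∀ {n} → SetSystem n → Fin n → PrimalType → Set
HasPrimalType 𝓕 e p = ¬ IsRibbonLoop 𝓕 e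
HasPrimalType 𝓕 e u = IsRibbonLoop 𝓕 e × ¬ IsRibbonLoop (twist 𝓕 ⁅ e ⁆) e
HasPrimalType 𝓕 e t = IsRibbonLoop 𝓕 e × IsRibbonLoop (twist 𝓕 ⁅ e ⁆) e

-- Deleting e does not change which elements f ≠ e avoid every minimum-size feasible set.
-- If e is a coloop, deletion removes e from every feasible set. Otherwise the minimum
-- feasible sets of D − e are exactly the minimum feasible sets of D avoiding e: the
-- exchange axiom turns a feasible set containing e into one avoiding e that is no larger,
-- and turns a minimum one X into a minimum one still containing X − e. Orientability is
-- the same question in D * f, and twisting by {f} commutes with deleting e and preserves
-- the delta-matroid axioms.
module Submission where

open import Defs
open import Data.Nat using (ℕ; suc; _≤_; _<_; s≤s)
open import Data.Nat.Properties using (≤-refl; ≤-trans; <⇒≤; <⇒≱; ≤-pred; ≤-reflexive; n<1+n; module ≤-Reasoning)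
open import Data.Bool using (true; false; _xor_)
open import Data.Bool.Properties using (xor-assoc; xor-comm; xor-identityˡ; xor-identityʳ; xor-annihilates-not)
open import Data.Fin using (Fin; zero; suc; punchIn)
open import Data.Fin.Properties using (punchInᵢ≢i; punchOut-punchIn) renaming (_≟_ to _≟ᶠ_)
open import Data.Fin.Subset using (Subset; _∈_; _∉_; _∪_; ⁅_⁆; ∣_∣) renaming (⊥ to ∅)
open import Data.Fin.Subset.Properties
  using (_∈?_; x∈⁅x⁆; x∈⁅y⁆⇒x≡y; x≢y⇒x∉⁅y⁆; x∈p∪q⁺; x∈p∪q⁻; ∪-idem; ∪-identityˡ; ∪-identityʳ)
open import Data.Vec using (Vec; []; _∷_; lookup; removeAt; here; there)
open import Data.Vec.Properties
  using (zipWith-assoc; zipWith-comm; zipWith-identityˡ; zipWith-identityʳ; lookup⇒[]=; []=⇒lookup; removeAt-punchOut)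
open import Data.Product using (_×_; _,_; proj₂; ∃-syntax)
open import Data.Product.Function.NonDependent.Propositional using (_×-⇔_)
open import Data.Sum using (_⊎_; inj₁; inj₂; [_,_]′)
open import Data.Empty using (⊥-elim)
open import Function using (_∘_; _⇔_; mk⇔; Equivalence)
open import Function.Construct.Composition using (_⇔-∘_)
open import Function.Related.TypeIsomorphisms using (¬-cong-⇔)
open import Relation.Nullary using (¬_; yes; no)
open import Relation.Unary using (_⊆_; _≐_)
open import Relation.Binary.PropositionalEquality
  using (_≡_; _≢_; refl; sym; trans; cong; cong₂; subst; subst₂)

private
  variable
    n : ℕ
    x y z : Fin n
    A X Y Z : Subset n

Δ-comm : (X Y : Subset n) → X Δ Y ≡ Y Δ X
Δ-comm = zipWith-comm xor-comm

Δ-assoc : (X Y Z : Subset n) → (X Δ Y) Δ Z ≡ X Δ (Y Δ Z)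
Δ-assoc = zipWith-assoc xor-assoc

Δ-identityˡ : (X : Subset n) → ∅ Δ X ≡ X
Δ-identityˡ = zipWith-identityˡ xor-identityˡ

Δ-identityʳ : (X : Subset n) → X Δ ∅ ≡ X
Δ-identityʳ = zipWith-identityʳ xor-identityʳ

Δ-cancelˡ : (A X Y : Subset n) → (A Δ X) Δ (A Δ Y) ≡ X Δ Y
Δ-cancelˡ []          []      []      = refl
Δ-cancelˡ (false ∷ A) (b ∷ X) (c ∷ Y) = cong ((b xor c) ∷_) (Δ-cancelˡ A X Y)
Δ-cancelˡ (true ∷ A)  (b ∷ X) (c ∷ Y) = cong₂ _∷_ (xor-annihilates-not b c) (Δ-cancelˡ A X Y)

∈Δ⁺ : x ∈ X → x ∉ Y → x ∈ X Δ Y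
∈Δ⁺ {Y = true  ∷ _} here         x∉Y = ⊥-elim (x∉Y here)
∈Δ⁺ {Y = false ∷ _} here         x∉Y = here
∈Δ⁺ {X = _ ∷ _} {Y = _ ∷ _} (there x∈X) x∉Y = there (∈Δ⁺ x∈X (x∉Y ∘ there))

∈Δ⁻ : x ∈ X Δ Y → x ∉ Y → x ∈ X
∈Δ⁻ {X = true ∷ _} {Y = false ∷ _} here x∉Y = here
∈Δ⁻ {X = false ∷ _} {Y = true ∷ _} here x∉Y = ⊥-elim (x∉Y here)
∈Δ⁻ {X = _ ∷ _} {Y = _ ∷ _} (there x∈XΔY) x∉Y = there (∈Δ⁻ x∈XΔY (x∉Y ∘ there))

∉Δ : x ∈ X → x ∈ Y → x ∉ X Δ Y
∉Δ here        here        ()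
∉Δ (there x∈X) (there x∈Y) (there x∈XΔY) = ∉Δ x∈X x∈Y x∈XΔY

∈Δˡ⁺ : x ∉ A → x ∈ X → x ∈ A Δ X
∈Δˡ⁺ {A = A} {X = X} x∉A x∈X = subst (_ ∈_) (Δ-comm X A) (∈Δ⁺ x∈X x∉A)

∈Δˡ⁻ : x ∉ A → x ∈ A Δ X → x ∈ X
∈Δˡ⁻ {A = A} {X = X} x∉A x∈AΔX = ∈Δ⁻ (subst (_ ∈_) (Δ-comm A X) x∈AΔX) x∉A

∣Δ⁅x⁆∣-∈ : x ∈ X → suc ∣ X Δ ⁅ x ⁆ ∣ ≡ ∣ X ∣
∣Δ⁅x⁆∣-∈ {X = true ∷ X} here        = cong (suc ∘ ∣_∣) (Δ-identityʳ X)
∣Δ⁅x⁆∣-∈ {X = true ∷ _} (there x∈X) = cong suc (∣Δ⁅x⁆∣-∈ x∈X)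
∣Δ⁅x⁆∣-∈ {X = false ∷ _} (there x∈X) = ∣Δ⁅x⁆∣-∈ x∈X

∣Δ⁅x⁆∣-∉ : x ∉ X → ∣ X Δ ⁅ x ⁆ ∣ ≡ suc ∣ X ∣
∣Δ⁅x⁆∣-∉ {x = zero}  {X = true ∷ _}  x∉X = ⊥-elim (x∉X here)
∣Δ⁅x⁆∣-∉ {x = zero}  {X = false ∷ X} x∉X = cong (suc ∘ ∣_∣) (Δ-identityʳ X)
∣Δ⁅x⁆∣-∉ {x = suc _} {X = true ∷ _}  x∉X = cong suc (∣Δ⁅x⁆∣-∉ (x∉X ∘ there))
∣Δ⁅x⁆∣-∉ {x = suc _} {X = false ∷ _} x∉X = ∣Δ⁅x⁆∣-∉ (x∉X ∘ there)

⁅x⁆∪⁅y⁆≡⁅x⁆Δ⁅y⁆ : x ≢ y → ⁅ x ⁆ ∪ ⁅ y ⁆ ≡ ⁅ x ⁆ Δ ⁅ y ⁆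
⁅x⁆∪⁅y⁆≡⁅x⁆Δ⁅y⁆ {x = zero}  {y = zero}  x≢y = ⊥-elim (x≢y refl)
⁅x⁆∪⁅y⁆≡⁅x⁆Δ⁅y⁆ {x = zero}  {y = suc y} _   =
  cong (true ∷_) (trans (∪-identityˡ ⁅ y ⁆) (sym (Δ-identityˡ ⁅ y ⁆)))
⁅x⁆∪⁅y⁆≡⁅x⁆Δ⁅y⁆ {x = suc x} {y = zero}  _   =
  cong (true ∷_) (trans (∪-identityʳ ⁅ x ⁆) (sym (Δ-identityʳ ⁅ x ⁆)))
⁅x⁆∪⁅y⁆≡⁅x⁆Δ⁅y⁆ {x = suc _} {y = suc _} x≢y = cong (false ∷_) (⁅x⁆∪⁅y⁆≡⁅x⁆Δ⁅y⁆ (x≢y ∘ cong suc))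

∣exchange∣ : x ∈ X →
  ∣ X Δ (⁅ x ⁆ ∪ ⁅ y ⁆) ∣ < ∣ X ∣ ⊎ (∣ X Δ (⁅ x ⁆ ∪ ⁅ y ⁆) ∣ ≡ ∣ X ∣ × y ∉ X)
∣exchange∣ {x = x} {X = X} {y = y} x∈X with y ≟ᶠ x
... | yes refl rewrite ∪-idem ⁅ x ⁆ = inj₁ (≤-reflexive (∣Δ⁅x⁆∣-∈ x∈X))
... | no y≢x rewrite ⁅x⁆∪⁅y⁆≡⁅x⁆Δ⁅y⁆ (y≢x ∘ sym) | sym (Δ-assoc X ⁅ x ⁆ ⁅ y ⁆) with y ∈? X
...   | yes y∈X = inj₁ (begin-strict
          ∣ (X Δ ⁅ x ⁆) Δ ⁅ y ⁆ ∣       <⟨ n<1+n _ ⟩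
          suc ∣ (X Δ ⁅ x ⁆) Δ ⁅ y ⁆ ∣   ≡⟨ ∣Δ⁅x⁆∣-∈ (∈Δ⁺ y∈X (x≢y⇒x∉⁅y⁆ y≢x)) ⟩
          ∣ X Δ ⁅ x ⁆ ∣                 <⟨ n<1+n _ ⟩
          suc ∣ X Δ ⁅ x ⁆ ∣             ≡⟨ ∣Δ⁅x⁆∣-∈ x∈X ⟩
          ∣ X ∣                         ∎)
          where open ≤-Reasoning
...   | no y∉X = inj₂ (trans (∣Δ⁅x⁆∣-∉ y∉XΔ⁅x⁆) (∣Δ⁅x⁆∣-∈ x∈X) , y∉X)
          where
          y∉XΔ⁅x⁆ : y ∉ X Δ ⁅ x ⁆
          y∉XΔ⁅x⁆ y∈XΔ⁅x⁆ = y∉X (∈Δ⁻ y∈XΔ⁅x⁆ (x≢y⇒x∉⁅y⁆ y≢x))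

∣exchange∣≤ : x ∈ X → ∣ X Δ (⁅ x ⁆ ∪ ⁅ y ⁆) ∣ ≤ ∣ X ∣
∣exchange∣≤ {y = y} x∈X = [ <⇒≤ , (λ (same , _) → ≤-reflexive same) ]′ (∣exchange∣ {y = y} x∈X)

∉exchange : x ∈ X → x ∉ X Δ (⁅ x ⁆ ∪ ⁅ y ⁆)
∉exchange x∈X = ∉Δ x∈X (x∈p∪q⁺ (inj₁ (x∈⁅x⁆ _)))

∈exchange : z ∈ X → y ∉ X → z ≢ x → z ∈ X Δ (⁅ x ⁆ ∪ ⁅ y ⁆)
∈exchange {X = X} {y = y} {x = x} z∈X y∉X z≢x = ∈Δ⁺ z∈X (λ z∈⁅x⁆∪⁅y⁆ →
  [ z≢x ∘ x∈⁅y⁆⇒x≡y x , (λ z∈⁅y⁆ → y∉X (subst (_∈ X) (x∈⁅y⁆⇒x≡y y z∈⁅y⁆) z∈X)) ]′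
  (x∈p∪q⁻ ⁅ x ⁆ ⁅ y ⁆ z∈⁅x⁆∪⁅y⁆))

lookup-removeAt : ∀ {a} {V : Set a} (xs : Vec V (suc n)) x y →
                  lookup (removeAt xs x) y ≡ lookup xs (punchIn x y)
lookup-removeAt xs x y =
  trans (cong (lookup (removeAt xs x)) (sym (punchOut-punchIn x)))
        (removeAt-punchOut xs (punchInᵢ≢i x y ∘ sym))

∈-removeAt⁺ : {X : Subset (suc n)} → punchIn x y ∈ X → y ∈ removeAt X x
∈-removeAt⁺ {x = x} {y = y} {X = X} h =
  lookup⇒[]= y (removeAt X x) (trans (lookup-removeAt X x y) ([]=⇒lookup h))

∈-removeAt⁻ : {X : Subset (suc n)} → y ∈ removeAt X x → punchIn x y ∈ X
∈-removeAt⁻ {y = y} {x = x} {X = X} h =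
  lookup⇒[]= (punchIn x y) X (trans (sym (lookup-removeAt X x y)) ([]=⇒lookup h))

∣removeAt∣-∈ : {X : Subset (suc n)} → x ∈ X → suc ∣ removeAt X x ∣ ≡ ∣ X ∣
∣removeAt∣-∈ {X = true ∷ _}      here        = refl
∣removeAt∣-∈ {X = true ∷ _ ∷ _}  (there x∈X) = cong suc (∣removeAt∣-∈ x∈X)
∣removeAt∣-∈ {X = false ∷ _ ∷ _} (there x∈X) = ∣removeAt∣-∈ x∈X

∣removeAt∣-∉ : {X : Subset (suc n)} → x ∉ X → ∣ removeAt X x ∣ ≡ ∣ X ∣
∣removeAt∣-∉ {x = zero}  {X = true ∷ _}      x∉X = ⊥-elim (x∉X here)
∣removeAt∣-∉ {x = zero}  {X = false ∷ _}     x∉X = refl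
∣removeAt∣-∉ {x = suc _} {X = true ∷ _ ∷ _}  x∉X = cong suc (∣removeAt∣-∉ (x∉X ∘ there))
∣removeAt∣-∉ {x = suc _} {X = false ∷ _ ∷ _} x∉X = ∣removeAt∣-∉ (x∉X ∘ there)

removeAt-Δ : (X Y : Subset (suc n)) (x : Fin (suc n)) →
             removeAt (X Δ Y) x ≡ removeAt X x Δ removeAt Y x
removeAt-Δ (_ ∷ _)     (_ ∷ _)     zero    = refl
removeAt-Δ (b ∷ c ∷ X) (d ∷ e ∷ Y) (suc x) = cong ((b xor d) ∷_) (removeAt-Δ (c ∷ X) (e ∷ Y) x)

removeAt-∷ : ∀ {a} {V : Set a} (v : V) (xs : Vec V (suc n)) x →
             removeAt (v ∷ xs) (suc x) ≡ v ∷ removeAt xs x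
removeAt-∷ v (_ ∷ _) x = refl

removeAt-∅ : (x : Fin (suc n)) → removeAt ∅ x ≡ ∅
removeAt-∅           zero    = refl
removeAt-∅ {n = suc _} (suc x) = cong (false ∷_) (removeAt-∅ x)

removeAt-⁅punchIn⁆ : (x : Fin (suc n)) (y : Fin n) → removeAt ⁅ punchIn x y ⁆ x ≡ ⁅ y ⁆
removeAt-⁅punchIn⁆ zero    y       = refl
removeAt-⁅punchIn⁆ (suc x) zero    = cong (true ∷_) (removeAt-∅ x)
removeAt-⁅punchIn⁆ (suc x) (suc y) =
  trans (removeAt-∷ false ⁅ punchIn x y ⁆ x) (cong (false ∷_) (removeAt-⁅punchIn⁆ x y))

twist-isDeltaMatroid : {F : SetSystem n} (A : Subset n) → IsDeltaMatroid F → IsDeltaMatroid (twist F A)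
twist-isDeltaMatroid A ((X , FX) , exchange) =
  (A Δ X , X , FX , refl) ,
  λ { _ _ (X , FX , refl) (Y , FY , refl) a a∈ →
      let (v , v∈ , F′) = exchange X Y FX FY a (subst (a ∈_) (Δ-cancelˡ A X Y) a∈)
      in v , subst (v ∈_) (sym (Δ-cancelˡ A X Y)) v∈ , (_ , F′ , Δ-assoc A X _) }

twistDM : DeltaMatroid n → Subset n → DeltaMatroid n
twistDM D A = record { isDeltaMatroid = twist-isDeltaMatroid A (isDeltaMatroid D) }

module _ {F : SetSystem n} where

  coloop-twist⁺ : x ∉ A → IsColoop F x → IsColoop (twist F A) x
  coloop-twist⁺ x∉A col _ (X , FX , refl) = ∈Δˡ⁺ x∉A (col X FX)

  coloop-twist⁻ : x ∉ A → IsColoop (twist F A) x → IsColoop F x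
  coloop-twist⁻ x∉A col X FX = ∈Δˡ⁻ x∉A (col _ (X , FX , refl))

twist-delete : {F : SetSystem (suc n)} {x : Fin (suc n)} {A : Subset (suc n)} → x ∉ A →
               twist (delete F x) (removeAt A x) ≐ delete (twist F A) x
twist-delete {F = F} {x} {A} x∉A = twist⊆delete , delete⊆twist
  where
  twist⊆delete : twist (delete F x) (removeAt A x) ⊆ delete (twist F A) x
  twist⊆delete (_ , inj₁ (col , X , FX , refl) , refl) =
    inj₁ (coloop-twist⁺ x∉A col , A Δ X , (X , FX , refl) , removeAt-Δ A X x)
  twist⊆delete (_ , inj₂ (¬col , X , FX , x∉X , refl) , refl) =
    inj₂ (¬col ∘ coloop-twist⁻ x∉A , A Δ X , (X , FX , refl) , x∉X ∘ ∈Δˡ⁻ x∉A ,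
          removeAt-Δ A X x)

  delete⊆twist : delete (twist F A) x ⊆ twist (delete F x) (removeAt A x)
  delete⊆twist (inj₁ (col , _ , (X , FX , refl) , refl)) =
    removeAt X x , inj₁ (coloop-twist⁻ x∉A col , X , FX , refl) , removeAt-Δ A X x
  delete⊆twist (inj₂ (¬col , _ , (X , FX , refl) , x∉AΔX , refl)) =
    removeAt X x , inj₂ (¬col ∘ coloop-twist⁺ x∉A , X , FX , x∉AΔX ∘ ∈Δˡ⁺ x∉A , refl) ,
    removeAt-Δ A X x

module Deletion {m : ℕ} (D : DeltaMatroid (suc m)) (e : Fin (suc m)) where

  private
    F : SetSystem (suc m)
    F = feasible D

  F∖e : SetSystem m
  F∖e = delete F e

  exchange : F X → F Y → e ∈ X → e ∉ Y → ∃[ v ] F (X Δ (⁅ e ⁆ ∪ ⁅ v ⁆))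
  exchange FX FY e∈X e∉Y =
    let (v , _ , F′) = proj₂ (isDeltaMatroid D) _ _ FX FY e (∈Δ⁺ e∈X e∉Y) in v , F′

  shrink-avoiding : F Y → e ∉ Y → F Z → ∃[ W ] F W × e ∉ W × ∣ W ∣ ≤ ∣ Z ∣
  shrink-avoiding {Z = Z} FY e∉Y FZ with e ∈? Z
  ... | no e∉Z = Z , FZ , e∉Z , ≤-refl
  ... | yes e∈Z = let (v , F′) = exchange FZ FY e∈Z e∉Y in
                  _ , F′ , ∉exchange e∈Z , ∣exchange∣≤ {y = v} e∈Z

  minimal-avoiding : minimal F X → e ∈ X → F Y → e ∉ Y →
                     ∃[ W ] minimal F W × e ∉ W × (∀ {z} → z ≢ e → z ∈ X → z ∈ W)
  minimal-avoiding (FX , minX) e∈X FY e∉Y with exchange FX FY e∈X e∉Y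
  ... | v , F′ with ∣exchange∣ {y = v} e∈X
  ...   | inj₁ smaller = ⊥-elim (<⇒≱ smaller (minX _ F′))
  ...   | inj₂ (same , v∉X) =
    _ , (F′ , λ Z FZ → subst (_≤ ∣ Z ∣) (sym same) (minX Z FZ)) , ∉exchange e∈X ,
    λ z≢e z∈X → ∈exchange z∈X v∉X z≢e

  minimal-delete-coloop : IsColoop F e → minimal F X → minimal F∖e (removeAt X e)
  minimal-delete-coloop col (FX , minX) = inj₁ (col , _ , FX , refl) , λ where
    _ (inj₁ (_ , Z , FZ , refl)) →
      ≤-pred (subst₂ _≤_ (sym (∣removeAt∣-∈ (col _ FX))) (sym (∣removeAt∣-∈ (col Z FZ))) (minX Z FZ))
    _ (inj₂ (¬col , _)) → ⊥-elim (¬col col)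

  avoided⇒¬coloop : F X → e ∉ X → ¬ IsColoop F e
  avoided⇒¬coloop FX e∉X col = e∉X (col _ FX)

  minimal-delete-avoiding : minimal F X → e ∉ X → minimal F∖e (removeAt X e)
  minimal-delete-avoiding (FX , minX) e∉X =
    inj₂ (avoided⇒¬coloop FX e∉X , _ , FX , e∉X , refl) , λ where
      _ (inj₁ (col , _)) → ⊥-elim (avoided⇒¬coloop FX e∉X col)
      _ (inj₂ (_ , Z , FZ , e∉Z , refl)) →
        subst₂ _≤_ (sym (∣removeAt∣-∉ e∉X)) (sym (∣removeAt∣-∉ e∉Z)) (minX Z FZ)

  minimal-delete⁻ : minimal F∖e Y → ∃[ X ] minimal F X × removeAt X e ≡ Y
  minimal-delete⁻ (inj₁ (col , X , FX , refl) , minY) = X , (FX , minX) , refl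
    where
    minX : ∀ Z → F Z → ∣ X ∣ ≤ ∣ Z ∣
    minX Z FZ = subst₂ _≤_ (∣removeAt∣-∈ (col X FX)) (∣removeAt∣-∈ (col Z FZ))
                  (s≤s (minY _ (inj₁ (col , Z , FZ , refl))))
  minimal-delete⁻ (inj₂ (¬col , X , FX , e∉X , refl) , minY) = X , (FX , minX) , refl
    where
    minX : ∀ Z → F Z → ∣ X ∣ ≤ ∣ Z ∣
    minX Z FZ =
      let (W , FW , e∉W , W≤Z) = shrink-avoiding FX e∉X FZ in
      ≤-trans (subst₂ _≤_ (∣removeAt∣-∉ e∉X) (∣removeAt∣-∉ e∉W)
                (minY _ (inj₂ (¬col , W , FW , e∉W , refl)))) W≤Z

  module _ (f : Fin m) where

    ribbonLoop-delete⁺ : IsRibbonLoop F (punchIn e f) → IsRibbonLoop F∖e f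
    ribbonLoop-delete⁺ rl Y minY f∈Y with minimal-delete⁻ minY
    ... | X , minX , refl = rl X minX (∈-removeAt⁻ f∈Y)

    ribbonLoop-delete⁻-avoiding : IsRibbonLoop F∖e f → minimal F X → e ∉ X → punchIn e f ∉ X
    ribbonLoop-delete⁻-avoiding rl minX e∉X f∈X =
      rl _ (minimal-delete-avoiding minX e∉X) (∈-removeAt⁺ f∈X)

    ribbonLoop-delete⁻ : IsRibbonLoop F∖e f → IsRibbonLoop F (punchIn e f)
    ribbonLoop-delete⁻ rl X minX f∈X with e ∈? X
    ... | no e∉X = ribbonLoop-delete⁻-avoiding rl minX e∉X f∈X
    ... | yes e∈X = rl _ (minimal-delete-coloop coloop minX) (∈-removeAt⁺ f∈X)
      where
      -- a feasible Y avoiding e would give a minimum feasible set avoiding e containing punchIn e f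
      coloop : IsColoop F e
      coloop Y FY with e ∈? Y
      ... | yes e∈Y = e∈Y
      ... | no e∉Y =
        let (W , minW , e∉W , keeps) = minimal-avoiding minX e∈X FY e∉Y in
        ⊥-elim (ribbonLoop-delete⁻-avoiding rl minW e∉W (keeps (punchInᵢ≢i e f) f∈X))

    ribbonLoop-delete : IsRibbonLoop F∖e f ⇔ IsRibbonLoop F (punchIn e f)
    ribbonLoop-delete = mk⇔ ribbonLoop-delete⁻ ribbonLoop-delete⁺

minimal-⊆ : {F G : SetSystem n} → F ≐ G → minimal F ⊆ minimal G
minimal-⊆ (F⊆G , G⊆F) (FX , minX) = F⊆G FX , λ Y GY → minX Y (G⊆F GY)

ribbonLoop-cong : {F G : SetSystem n} → F ≐ G → IsRibbonLoop F x ⇔ IsRibbonLoop G x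
ribbonLoop-cong (F⊆G , G⊆F) = mk⇔
  (λ rl X minX → rl X (minimal-⊆ (G⊆F , F⊆G) minX))
  (λ rl X minX → rl X (minimal-⊆ (F⊆G , G⊆F) minX))

primalType-cong : ∀ {n n′} {F : SetSystem n} {G : SetSystem n′} {x y} →
  IsRibbonLoop F x ⇔ IsRibbonLoop G y →
  IsRibbonLoop (twist F ⁅ x ⁆) x ⇔ IsRibbonLoop (twist G ⁅ y ⁆) y →
  ∀ τ → HasPrimalType F x τ ⇔ HasPrimalType G y τ
primalType-cong loop twisted-loop p = ¬-cong-⇔ loop
primalType-cong loop twisted-loop u = loop ×-⇔ ¬-cong-⇔ twisted-loop
primalType-cong loop twisted-loop t = loop ×-⇔ twisted-loop

lemma3 : ∀ {m : ℕ} (D : DeltaMatroid (suc m)) (e₁ : Fin (suc m)) (e₂ : Fin m)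
         (τ : PrimalType) →
         (HasPrimalType (delete (feasible D) e₁) e₂ τ → HasPrimalType (feasible D) (punchIn e₁ e₂) τ) ×
         (HasPrimalType (feasible D) (punchIn e₁ e₂) τ → HasPrimalType (delete (feasible D) e₁) e₂ τ)
lemma3 {m} D e₁ e₂ τ = Equivalence.to types , Equivalence.from types
  where
  F : SetSystem (suc m)
  F = feasible D

  e₂′ : Fin (suc m)
  e₂′ = punchIn e₁ e₂

  twist-commutes : twist (delete F e₁) ⁅ e₂ ⁆ ≐ delete (twist F ⁅ e₂′ ⁆) e₁
  twist-commutes = subst (λ A → twist (delete F e₁) A ≐ delete (twist F ⁅ e₂′ ⁆) e₁)
    (removeAt-⁅punchIn⁆ e₁ e₂) (twist-delete (x≢y⇒x∉⁅y⁆ (punchInᵢ≢i e₁ e₂ ∘ sym)))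

  types : HasPrimalType (delete F e₁) e₂ τ ⇔ HasPrimalType F e₂′ τ
  types = primalType-cong
    (Deletion.ribbonLoop-delete D e₁ e₂)
    (Deletion.ribbonLoop-delete (twistDM D ⁅ e₂′ ⁆) e₁ e₂ ⇔-∘ ribbonLoop-cong twist-commutes)
    τ
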